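{- Let $n\ge2$ and $s,t$ nonnegative integers. If $s\ne t$, $$\#\{\pi\in\mathrm{PF}(n):\mathrm{lel}(\pi)=s+1,\ \mathrm{nlel}(\pi)=t+1\}=\binom{n-2}{s,\,t,\,n-s-t-2}\,n\,(n-1)^{n-s-t-2},$$ and if $s=t$, $$\#\{\pi\in\mathrm{PF}(n):\mathrm{lel}(\pi)=s+1,\ \mathrm{nlel}(\pi)=s+1\}=\binom{n-2}{s,\,s,\,n-2s-2}\,n\,(n-1)^{n-2s-2}+\binom{n-2}{s-1}n^{n-s-1}.$$
   Context: $\mathrm{PF}(n)$ is the set of sequences $\pi=(\pi_1,\dots,\pi_n)$ of positive integers whose increasing rearrangement $b_1\le\dots\le b_n$ satisfies $b_i\le i$. $\mathrm{lel}(\pi)=\#\{i:\pi_i=\pi_1\}$, $\mathrm{nlel}(\pi)=\#\{i:\pi_i=\pi_2\}$. Binomial and multinomial coefficients with a negative lower entry (or lower entry exceeding the upper) are $0$. -}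

module Defs where

open import Data.Nat using (ℕ; zero; suc; _+_; _*_; _∸_; _^_; _≤_; _≤?_; _≟_)
open import Data.Nat.Properties using (≤-decTotalOrder)
open import Data.Nat.Combinatorics using (_C_)
open import Data.List using (List; []; _∷_; length; filterᵇ; map; concatMap; upTo; zip; allFin)
open import Data.List.Relation.Unary.All using (All)
open import Data.Product using (_×_; _,_; proj₁; proj₂)
open import Relation.Nullary using (Dec; yes; no)
open import Relation.Nullary.Decidable using (⌊_⌋)
open import Data.Bool using (Bool; true; false; if_then_else_; T)
import Data.List.Sort.InsertionSort.Base

open Data.List.Sort.InsertionSort.Base ≤-decTotalOrder using (sort)

seqs : ℕ → ℕ → List (List ℕ)
seqs m zero    = [] ∷ []
seqs m (suc k) = concatMap (λ x → map (x ∷_) (seqs m k)) (map suc (upTo m))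

-- increasing rearrangement b₁ ≤ … ≤ bₙ satisfies bᵢ ≤ i  (i = 1,…,n)
boundedFrom : ℕ → List ℕ → Bool
boundedFrom i []       = true
boundedFrom i (b ∷ bs) = if ⌊ b ≤? i ⌋ then boundedFrom (suc i) bs else false

IsPF : List ℕ → Set
IsPF π = T (boundedFrom 1 (sort π))

isPF? : List ℕ → Bool
isPF? π = boundedFrom 1 (sort π)

countEq : ℕ → List ℕ → ℕ
countEq x []       = 0
countEq x (y ∷ ys) = if ⌊ y ≟ x ⌋ then suc (countEq x ys) else countEq x ys

lel : List ℕ → ℕ
lel []          = 0
lel π@(x ∷ _)   = countEq x π

nlel : List ℕ → ℕ
nlel []              = 0
nlel (x ∷ [])        = 0
nlel π@(_ ∷ y ∷ _)   = countEq y π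

-- #{π ∈ PF(n) : lel π = a, nlel π = b}.  Every parking function of length n
-- has entries in {1,…,n} (since bᵢ ≤ i ≤ n), so enumerating {1..n}^n is exhaustive.
countPF : ℕ → ℕ → ℕ → ℕ
countPF n a b =
  length (filterᵇ (λ π → isPF? π Data.Bool.∧ (⌊ lel π ≟ a ⌋ Data.Bool.∧ ⌊ nlel π ≟ b ⌋)) (seqs n n))

-- multinomial (m ; a , b , m - a - b), zero when a + b > m
multinom3 : ℕ → ℕ → ℕ → ℕ
multinom3 m a b = if ⌊ a + b ≤? m ⌋ then (m C a) * ((m ∸ a) C b) else 0

-- binomial (m choose s-1), zero when s = 0
binomPred : ℕ → ℕ → ℕ
binomPred m zero    = 0
binomPred m (suc s) = m C s

-- Rotating every entry of a word π ∈ {1,…,n+1}^n by v ↦ v + c (mod n+1) preserves lel and nlel, and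
-- exactly one of the n+1 rotations of π is a parking function: the one that starts counting at the
-- leftmost minimum of i ↦ #{entries ≤ i} − i (Pollak). So (n+1)·#{π ∈ PF(n) : lel = s+1, nlel = t+1}
-- counts all words in {1,…,n+1}^n with these statistics. Sort those by their first two letters x, y:
-- for x ≠ y the remaining n−2 letters contain exactly s copies of x and t of y, giving
-- (n−2 choose s, t, n−s−t−2)(n−1)^(n−s−t−2) words; for x = y necessarily s = t, and the rest contains
-- s−1 copies of x, giving (n−2 choose s−1) n^(n−s−1) words. There are (n+1)n pairs of the first kind and
-- n+1 of the second.

module Submission where

open import Defs
open import Data.Nat
open import Data.Nat.Combinatorics using (_C_; nCk+nC[k+1]≡[n+1]C[k+1]; k>n⇒nCk≡0)
open import Data.Nat.Properties
open import Data.Nat.Solver using (module +-*-Solver)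
open import Algebra.Properties.CommutativeSemigroup +-commutativeSemigroup
  using (interchange; xy∙z≈xz∙y; x∙yz≈y∙xz)
open import Algebra.Properties.CommutativeSemigroup *-commutativeSemigroup
  using () renaming (x∙yz≈y∙xz to *-left-comm)
open import Data.Bool using (Bool; true; false; if_then_else_; T; _∧_)
open import Data.Bool.Properties using (∧-comm; ∧-zeroʳ; ∧-idem)
open import Data.Empty using (⊥; ⊥-elim)
open import Data.List using (List; []; _∷_; length; filterᵇ; map; concatMap; applyUpTo; _++_)
open import Data.List.Properties using (length-map; length-++; filter-++; map-applyUpTo)
open import Data.List.Relation.Binary.Permutation.Propositional as ↭ using (_↭_; prep; swap)
open import Data.List.Relation.Binary.Permutation.Propositional.Properties using (↭-length)
open import Data.List.Relation.Unary.All using (All; []; _∷_; all?) renaming (map to All-map)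
open import Data.List.Relation.Unary.Linked using ([]; [-]; _∷_) renaming (tail to sorted-tail)
open import Data.List.Relation.Unary.Linked.Properties using (Linked⇒All)
open import Data.List.Relation.Unary.Sorted.TotalOrder ≤-totalOrder using (Sorted)
open import Data.List.Sort.InsertionSort.Base ≤-decTotalOrder using (sort)
open import Data.List.Sort.InsertionSort.Properties ≤-decTotalOrder using (sort-↭; sort-↗)
open import Data.Product using (∃; _×_; _,_; proj₁; proj₂)
open import Data.Unit using (tt)
open import Function using (_∘_; id)
open import Relation.Binary.Definitions using (tri<; tri≈; tri>)
open import Relation.Binary.PropositionalEquality
open import Relation.Nullary using (yes; no; ¬_)
open import Relation.Nullary.Decidable using (⌊_⌋; T?)

open ≡-Reasoning
open +-*-Solver using (solve; _:+_; _:*_; _:=_; con)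

𝟙 : Bool → ℕ
𝟙 true  = 1
𝟙 false = 0

𝟙[_≤_] : ℕ → ℕ → ℕ
𝟙[ a ≤ b ] = 𝟙 ⌊ a ≤? b ⌋

𝟙[≤]-yes : ∀ {a b} → a ≤ b → 𝟙[ a ≤ b ] ≡ 1
𝟙[≤]-yes {a} {b} a≤b with a ≤? b
... | yes _   = refl
... | no  a≰b = ⊥-elim (a≰b a≤b)

𝟙[≤]-no : ∀ {a b} → b < a → 𝟙[ a ≤ b ] ≡ 0
𝟙[≤]-no {a} {b} b<a with a ≤? b
... | yes a≤b = ⊥-elim (<⇒≱ b<a a≤b)
... | no  _   = refl

𝟙[≤]-cong : ∀ {a b a' b'} → (a ≤ b → a' ≤ b') → (a' ≤ b' → a ≤ b) → 𝟙[ a ≤ b ] ≡ 𝟙[ a' ≤ b' ]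
𝟙[≤]-cong {a} {b} {a'} {b'} to from with a' ≤? b'
... | yes a'≤b' = 𝟙[≤]-yes (from a'≤b')
... | no  a'≰b' = 𝟙[≤]-no (≰⇒> (a'≰b' ∘ to))

-- Sums over {1,…,m} and over words

sumTo : ℕ → (ℕ → ℕ) → ℕ
sumTo zero    g = 0
sumTo (suc m) g = sumTo m g + g (suc m)

sumTo-cong : ∀ m {g h : ℕ → ℕ} → (∀ i → 1 ≤ i → i ≤ m → g i ≡ h i) → sumTo m g ≡ sumTo m h
sumTo-cong zero    g≡h = refl
sumTo-cong (suc m) g≡h =
  cong₂ _+_ (sumTo-cong m (λ i 1≤i i≤m → g≡h i 1≤i (m≤n⇒m≤1+n i≤m))) (g≡h (suc m) (s≤s z≤n) ≤-refl)

sumTo-unfoldˡ : ∀ m g → sumTo (suc m) g ≡ g 1 + sumTo m (g ∘ suc)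
sumTo-unfoldˡ zero    g = +-comm 0 (g 1)
sumTo-unfoldˡ (suc m) g = begin
  sumTo (suc m) g + g (2 + m)           ≡⟨ cong (_+ g (2 + m)) (sumTo-unfoldˡ m g) ⟩
  g 1 + sumTo m (g ∘ suc) + g (2 + m)   ≡⟨ +-assoc (g 1) _ _ ⟩
  g 1 + sumTo (suc m) (g ∘ suc)         ∎

sumTo-distrib-+ : ∀ m g h → sumTo m (λ i → g i + h i) ≡ sumTo m g + sumTo m h
sumTo-distrib-+ zero    g h = refl
sumTo-distrib-+ (suc m) g h = begin
  sumTo m (λ i → g i + h i) + (g (suc m) + h (suc m))
    ≡⟨ cong (_+ (g (suc m) + h (suc m))) (sumTo-distrib-+ m g h) ⟩
  sumTo m g + sumTo m h + (g (suc m) + h (suc m))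
    ≡⟨ interchange (sumTo m g) (sumTo m h) _ _ ⟩
  sumTo m g + g (suc m) + (sumTo m h + h (suc m)) ∎

sumTo-const : ∀ m c → sumTo m (λ _ → c) ≡ m * c
sumTo-const zero    c = refl
sumTo-const (suc m) c = trans (cong (_+ c) (sumTo-const m c)) (+-comm (m * c) c)

sumTo-zero : ∀ m g → (∀ i → 1 ≤ i → i ≤ m → g i ≡ 0) → sumTo m g ≡ 0
sumTo-zero m g g≡0 = trans (sumTo-cong m g≡0) (trans (sumTo-const m 0) (*-zeroʳ m))

sumTo-splitAt : ∀ a b g → sumTo (a + b) g ≡ sumTo a g + sumTo b (λ i → g (a + i))
sumTo-splitAt a zero    g = trans (cong (λ z → sumTo z g) (+-identityʳ a)) (sym (+-identityʳ _))
sumTo-splitAt a (suc b) g = begin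
  sumTo (a + suc b) g                                   ≡⟨ cong (λ z → sumTo z g) (+-suc a b) ⟩
  sumTo (a + b) g + g (suc (a + b))                     ≡⟨ cong₂ _+_ (sumTo-splitAt a b g) (cong g (sym (+-suc a b))) ⟩
  sumTo a g + sumTo b (λ i → g (a + i)) + g (a + suc b) ≡⟨ +-assoc (sumTo a g) _ _ ⟩
  sumTo a g + sumTo (suc b) (λ i → g (a + i))           ∎

sumTo-𝟙∧ : ∀ m a (b : ℕ → Bool) → sumTo m (λ j → 𝟙 (a ∧ b j)) ≡ 𝟙 a * sumTo m (𝟙 ∘ b)
sumTo-𝟙∧ m true  b = sym (+-identityʳ _)
sumTo-𝟙∧ m false b = sumTo-zero m _ (λ _ _ _ → refl)

sumTo-update : ∀ m x g h → 1 ≤ x → x ≤ m → (∀ z → 1 ≤ z → z ≤ m → z ≢ x → g z ≡ h z) →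
  sumTo m g + h x ≡ sumTo m h + g x
sumTo-update zero    x g h 1≤x x≤0 _ = ⊥-elim (<⇒≱ 1≤x x≤0)
sumTo-update (suc m) x g h 1≤x x≤1+m g≡h with x ≟ suc m
... | yes refl = begin
  sumTo m g + g x + h x ≡⟨ cong (λ s → s + g x + h x) (sumTo-cong m g≡h-below) ⟩
  sumTo m h + g x + h x ≡⟨ xy∙z≈xz∙y (sumTo m h) (g x) (h x) ⟩
  sumTo m h + h x + g x ∎
  where
  g≡h-below : ∀ z → 1 ≤ z → z ≤ m → g z ≡ h z
  g≡h-below z 1≤z z≤m = g≡h z 1≤z (m≤n⇒m≤1+n z≤m) (<⇒≢ (s≤s z≤m))
... | no x≢1+m = begin
  sumTo m g + g (suc m) + h x   ≡⟨ xy∙z≈xz∙y (sumTo m g) (g (suc m)) (h x) ⟩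
  sumTo m g + h x + g (suc m)   ≡⟨ cong₂ _+_ IH (g≡h (suc m) (s≤s z≤n) ≤-refl (x≢1+m ∘ sym)) ⟩
  sumTo m h + g x + h (suc m)   ≡⟨ xy∙z≈xz∙y (sumTo m h) (g x) (h (suc m)) ⟩
  sumTo m h + h (suc m) + g x   ∎
  where
  IH : sumTo m g + h x ≡ sumTo m h + g x
  IH = sumTo-update m x g h 1≤x (≤-pred (≤∧≢⇒< x≤1+m x≢1+m))
         (λ z 1≤z z≤m → g≡h z 1≤z (m≤n⇒m≤1+n z≤m))

sumTo-except₁ : ∀ m x A B g → 1 ≤ x → x ≤ m → g x ≡ A → (∀ z → 1 ≤ z → z ≤ m → z ≢ x → g z ≡ B) →
  sumTo m g + B ≡ A + m * B
sumTo-except₁ m x A B g 1≤x x≤m gx≡A g≡B = begin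
  sumTo m g + B             ≡⟨ sumTo-update m x g (λ _ → B) 1≤x x≤m g≡B ⟩
  sumTo m (λ _ → B) + g x   ≡⟨ cong₂ _+_ (sumTo-const m B) gx≡A ⟩
  m * B + A                 ≡⟨ +-comm (m * B) A ⟩
  A + m * B                 ∎

sumTo-except₂ : ∀ m x y A B K g → x ≢ y → 1 ≤ x → x ≤ m → 1 ≤ y → y ≤ m → g x ≡ A → g y ≡ B →
  (∀ z → 1 ≤ z → z ≤ m → z ≢ x → z ≢ y → g z ≡ K) → sumTo m g + K + K ≡ A + B + m * K
sumTo-except₂ m x y A B K g x≢y 1≤x x≤m 1≤y y≤m gx≡A gy≡B g≡K = begin
  sumTo m g + K + K     ≡⟨ cong (λ k → sumTo m g + k + K) g'x≡K ⟨
  sumTo m g + g' x + K  ≡⟨ cong (_+ K) (sumTo-update m x g g' 1≤x x≤m g≡g') ⟩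
  sumTo m g' + g x + K  ≡⟨ xy∙z≈xz∙y (sumTo m g') (g x) K ⟩
  sumTo m g' + K + g x  ≡⟨ cong₂ _+_ (sumTo-except₁ m y B K g' 1≤y y≤m g'y≡B g'≡K) gx≡A ⟩
  B + m * K + A         ≡⟨ solve 3 (λ A B M → B :+ M :+ A := A :+ B :+ M) refl A B (m * K) ⟩
  A + B + m * K         ∎
  where
  g' : ℕ → ℕ
  g' z = if ⌊ z ≟ x ⌋ then K else g z
  g≡g' : ∀ z → 1 ≤ z → z ≤ m → z ≢ x → g z ≡ g' z
  g≡g' z _ _ z≢x with z ≟ x
  ... | yes z≡x = ⊥-elim (z≢x z≡x)
  ... | no  _   = refl
  g'y≡B : g' y ≡ B
  g'y≡B = trans (sym (g≡g' y 1≤y y≤m (x≢y ∘ sym))) gy≡B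
  g'≡K : ∀ z → 1 ≤ z → z ≤ m → z ≢ y → g' z ≡ K
  g'≡K z 1≤z z≤m z≢y with z ≟ x
  ... | yes _   = refl
  ... | no  z≢x = g≡K z 1≤z z≤m z≢x z≢y
  g'x≡K : g' x ≡ K
  g'x≡K with x ≟ x
  ... | yes _   = refl
  ... | no  x≢x = ⊥-elim (x≢x refl)

sumTo-𝟙-unique : ∀ m (b : ℕ → Bool) → (∃ λ j → 1 ≤ j × j ≤ m × T (b j)) →
  (∀ j j' → 1 ≤ j → j ≤ m → 1 ≤ j' → j' ≤ m → T (b j) → T (b j') → j ≡ j') →
  sumTo m (𝟙 ∘ b) ≡ 1
sumTo-𝟙-unique zero    b (j , 1≤j , j≤0 , _) _ = ⊥-elim (<⇒≱ 1≤j j≤0)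
sumTo-𝟙-unique (suc m) b (j , 1≤j , j≤1+m , bj) unique with b (suc m) in b[1+m]
... | true  = cong (_+ 1) (sumTo-zero m _ none-below)
  where
  none-below : ∀ i → 1 ≤ i → i ≤ m → 𝟙 (b i) ≡ 0
  none-below i 1≤i i≤m with b i in bi
  ... | false = refl
  ... | true  = ⊥-elim (<⇒≢ (s≤s i≤m)
                  (unique i (suc m) 1≤i (m≤n⇒m≤1+n i≤m) (s≤s z≤n) ≤-refl
                     (subst T (sym bi) tt) (subst T (sym b[1+m]) tt)))
... | false = trans (+-identityʳ _)
                (sumTo-𝟙-unique m b (j , 1≤j , j≤m , bj)
                   (λ j j' 1≤j j≤m 1≤j' j'≤m → unique j j' 1≤j (m≤n⇒m≤1+n j≤m) 1≤j' (m≤n⇒m≤1+n j'≤m)))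
  where
  j≤m : j ≤ m
  j≤m with j ≟ suc m
  ... | no  j≢1+m = ≤-pred (≤∧≢⇒< j≤1+m j≢1+m)
  ... | yes refl  = ⊥-elim (subst T b[1+m] bj)

InRange : ℕ → ℕ → Set
InRange m v = 1 ≤ v × v ≤ m

Word : ℕ → ℕ → List ℕ → Set
Word m k π = length π ≡ k × All (InRange m) π

_∷ʷ_ : ∀ {m k x ρ} → InRange m x → Word m k ρ → Word m (suc k) (x ∷ ρ)
x∈ ∷ʷ (refl , ρ∈) = refl , x∈ ∷ ρ∈

sumWords : ℕ → ℕ → (List ℕ → ℕ) → ℕ
sumWords m zero    F = F []
sumWords m (suc k) F = sumTo m (λ x → sumWords m k (F ∘ (x ∷_)))

sumWords-cong : ∀ m k {F G : List ℕ → ℕ} → (∀ π → Word m k π → F π ≡ G π) → sumWords m k F ≡ sumWords m k G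
sumWords-cong m zero    F≡G = F≡G [] (refl , [])
sumWords-cong m (suc k) F≡G =
  sumTo-cong m (λ x 1≤x x≤m → sumWords-cong m k (λ ρ ρ∈ → F≡G (x ∷ ρ) ((1≤x , x≤m) ∷ʷ ρ∈)))

sumWords-zero : ∀ m k F → (∀ π → Word m k π → F π ≡ 0) → sumWords m k F ≡ 0
sumWords-zero m zero    F F≡0 = F≡0 [] (refl , [])
sumWords-zero m (suc k) F F≡0 =
  sumTo-zero m _ (λ x 1≤x x≤m → sumWords-zero m k _ (λ ρ ρ∈ → F≡0 (x ∷ ρ) ((1≤x , x≤m) ∷ʷ ρ∈)))

sumWords-distrib-+ : ∀ m k F G → sumWords m k (λ π → F π + G π) ≡ sumWords m k F + sumWords m k G
sumWords-distrib-+ m zero    F G = refl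
sumWords-distrib-+ m (suc k) F G =
  trans (sumTo-cong m (λ x _ _ → sumWords-distrib-+ m k (F ∘ (x ∷_)) (G ∘ (x ∷_)))) (sumTo-distrib-+ m _ _)

sumWords-sumTo : ∀ m k j (H : ℕ → List ℕ → ℕ) →
  sumWords m k (λ π → sumTo j (λ c → H c π)) ≡ sumTo j (λ c → sumWords m k (H c))
sumWords-sumTo m k zero    H = sumWords-zero m k _ (λ _ _ → refl)
sumWords-sumTo m k (suc j) H =
  trans (sumWords-distrib-+ m k _ _) (cong (_+ sumWords m k (H (suc j))) (sumWords-sumTo m k j H))

sumWords-restrict : ∀ m k F → (∀ π → Word (suc m) k π → ¬ All (_≤ m) π → F π ≡ 0) →
  sumWords (suc m) k F ≡ sumWords m k F
sumWords-restrict m zero    F _   = refl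
sumWords-restrict m (suc k) F F≡0 = begin
  sumTo m (λ x → sumWords (suc m) k (F ∘ (x ∷_))) + sumWords (suc m) k (F ∘ (suc m ∷_))
    ≡⟨ cong₂ _+_ (sumTo-cong m shorter) (sumWords-zero (suc m) k _ starts-with-1+m) ⟩
  sumWords m (suc k) F + 0
    ≡⟨ +-identityʳ _ ⟩
  sumWords m (suc k) F ∎
  where
  shorter : ∀ x → 1 ≤ x → x ≤ m → sumWords (suc m) k (F ∘ (x ∷_)) ≡ sumWords m k (F ∘ (x ∷_))
  shorter x 1≤x x≤m = sumWords-restrict m k (F ∘ (x ∷_))
    (λ ρ ρ∈ ρ≰m → F≡0 (x ∷ ρ) ((1≤x , m≤n⇒m≤1+n x≤m) ∷ʷ ρ∈) (λ { (_ ∷ ρ≤m) → ρ≰m ρ≤m }))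
  starts-with-1+m : ∀ ρ → Word (suc m) k ρ → F (suc m ∷ ρ) ≡ 0
  starts-with-1+m ρ ρ∈ = F≡0 (suc m ∷ ρ) ((s≤s z≤n , ≤-refl) ∷ʷ ρ∈) (λ { (1+m≤m ∷ _) → 1+n≰n 1+m≤m })

length-filter-++ : ∀ (p : List ℕ → Bool) xs ys →
  length (filterᵇ p (xs ++ ys)) ≡ length (filterᵇ p xs) + length (filterᵇ p ys)
length-filter-++ p xs ys = trans (cong length (filter-++ (T? ∘ p) xs ys)) (length-++ (filterᵇ p xs))

length-filter-map-∷ : ∀ (p : List ℕ → Bool) x πs →
  length (filterᵇ p (map (x ∷_) πs)) ≡ length (filterᵇ (p ∘ (x ∷_)) πs)
length-filter-map-∷ p x []       = refl
length-filter-map-∷ p x (π ∷ πs) with p (x ∷ π)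
... | true  = cong suc (length-filter-map-∷ p x πs)
... | false = length-filter-map-∷ p x πs

length-filter-concatMap-applyUpTo : ∀ m f (h : ℕ → List (List ℕ)) (p : List ℕ → Bool) →
  length (filterᵇ p (concatMap h (applyUpTo f m))) ≡ sumTo m (λ i → length (filterᵇ p (h (f (pred i)))))
length-filter-concatMap-applyUpTo zero    f h p = refl
length-filter-concatMap-applyUpTo (suc m) f h p = begin
  length (filterᵇ p (h (f 0) ++ concatMap h (applyUpTo (f ∘ suc) m)))
    ≡⟨ length-filter-++ p (h (f 0)) _ ⟩
  length (filterᵇ p (h (f 0))) + length (filterᵇ p (concatMap h (applyUpTo (f ∘ suc) m)))
    ≡⟨ cong (length (filterᵇ p (h (f 0))) +_) (length-filter-concatMap-applyUpTo m (f ∘ suc) h p) ⟩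
  length (filterᵇ p (h (f 0))) + sumTo m (λ i → length (filterᵇ p (h (f (suc (pred i))))))
    ≡⟨ cong (length (filterᵇ p (h (f 0))) +_) (sumTo-cong m (λ { (suc i) _ _ → refl })) ⟩
  length (filterᵇ p (h (f 0))) + sumTo m (λ i → length (filterᵇ p (h (f i))))
    ≡⟨ sumTo-unfoldˡ m _ ⟨
  sumTo (suc m) (λ i → length (filterᵇ p (h (f (pred i))))) ∎

length-filter-seqs : ∀ m k (p : List ℕ → Bool) → length (filterᵇ p (seqs m k)) ≡ sumWords m k (𝟙 ∘ p)
length-filter-seqs m zero    p with p []
... | true  = refl
... | false = refl
length-filter-seqs m (suc k) p = begin
  length (filterᵇ p (concatMap (λ x → map (x ∷_) (seqs m k)) (map suc (applyUpTo id m))))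
    ≡⟨ cong (λ xs → length (filterᵇ p (concatMap (λ x → map (x ∷_) (seqs m k)) xs))) (map-applyUpTo id suc m) ⟩
  length (filterᵇ p (concatMap (λ x → map (x ∷_) (seqs m k)) (applyUpTo suc m)))
    ≡⟨ length-filter-concatMap-applyUpTo m suc _ p ⟩
  sumTo m (λ i → length (filterᵇ p (map (suc (pred i) ∷_) (seqs m k))))
    ≡⟨ sumTo-cong m (λ { (suc i) _ _ → trans (length-filter-map-∷ p (suc i) (seqs m k)) (length-filter-seqs m k _) }) ⟩
  sumWords m (suc k) (𝟙 ∘ p) ∎

-- Parking functions by counting

countLe : ℕ → List ℕ → ℕ
countLe k []      = 0
countLe k (v ∷ π) = 𝟙[ v ≤ k ] + countLe k π

countLe-↭ : ∀ k {xs ys} → xs ↭ ys → countLe k xs ≡ countLe k ys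
countLe-↭ k ↭.refl          = refl
countLe-↭ k (prep x xs↭ys)   = cong (𝟙[ x ≤ k ] +_) (countLe-↭ k xs↭ys)
countLe-↭ k (swap x y xs↭ys) =
  trans (x∙yz≈y∙xz 𝟙[ x ≤ k ] 𝟙[ y ≤ k ] _)
        (cong (λ c → 𝟙[ y ≤ k ] + (𝟙[ x ≤ k ] + c)) (countLe-↭ k xs↭ys))
countLe-↭ k (↭.trans p q)    = trans (countLe-↭ k p) (countLe-↭ k q)

countLe-≤-length : ∀ k π → countLe k π ≤ length π
countLe-≤-length k []      = z≤n
countLe-≤-length k (v ∷ π) with v ≤? k
... | yes _ = s≤s (countLe-≤-length k π)
... | no  _ = m≤n⇒m≤1+n (countLe-≤-length k π)

countLe-<-length : ∀ k π → ¬ All (_≤ k) π → countLe k π < length π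
countLe-<-length k []      π≰k = ⊥-elim (π≰k [])
countLe-<-length k (v ∷ π) vπ≰k with v ≤? k
... | yes v≤k = s≤s (countLe-<-length k π (vπ≰k ∘ (v≤k ∷_)))
... | no  _   = s≤s (countLe-≤-length k π)

countLe-none : ∀ {k} π → All (k <_) π → countLe k π ≡ 0
countLe-none []      []           = refl
countLe-none (v ∷ π) (k<v ∷ k<π) = cong₂ _+_ (𝟙[≤]-no k<v) (countLe-none π k<π)

countLe-all : ∀ {k} π → All (_≤ k) π → countLe k π ≡ length π
countLe-all []      []           = refl
countLe-all (v ∷ π) (v≤k ∷ π≤k) = cong₂ _+_ (𝟙[≤]-yes v≤k) (countLe-all π π≤k)

ParkingCounts : List ℕ → Set
ParkingCounts π = ∀ k → 1 ≤ k → k ≤ length π → k ≤ countLe k π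

CountsFrom : ℕ → List ℕ → Set
CountsFrom i b = ∀ k → i ≤ k → k < i + length b → suc k ≤ countLe k b + i

sorted-head : ∀ {x bs} → Sorted (x ∷ bs) → All (x ≤_) bs
sorted-head [-]          = []
sorted-head (x≤y ∷ ys↗)  = Linked⇒All ≤-trans x≤y ys↗

countLe-∷-≤ : ∀ {x k} π → x ≤ k → countLe k (x ∷ π) ≡ suc (countLe k π)
countLe-∷-≤ π x≤k = cong (_+ countLe _ π) (𝟙[≤]-yes x≤k)

boundedFrom⇒CountsFrom : ∀ i b → Sorted b → T (boundedFrom i b) → CountsFrom i b
boundedFrom⇒CountsFrom i [] _ _ k i≤k k<i+0 = ⊥-elim (<⇒≱ k<i+0 (subst (_≤ k) (sym (+-identityʳ i)) i≤k))
boundedFrom⇒CountsFrom i (x ∷ bs) b↗ bounded k i≤k k<i+|b| with x ≤? i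
... | no  _   = ⊥-elim bounded
... | yes x≤i with i ≟ k
...   | yes refl = subst (suc i ≤_) (sym (cong (_+ i) (countLe-∷-≤ bs x≤i))) (s≤s (m≤n+m i _))
...   | no  i≢k  = subst (suc k ≤_) (sym shift)
                     (boundedFrom⇒CountsFrom (suc i) bs (sorted-tail b↗) bounded k (≤∧≢⇒< i≤k i≢k)
                        (subst (k <_) (+-suc i (length bs)) k<i+|b|))
  where
  shift : countLe k (x ∷ bs) + i ≡ countLe k bs + suc i
  shift = trans (cong (_+ i) (countLe-∷-≤ bs (≤-trans x≤i i≤k))) (sym (+-suc _ i))

CountsFrom⇒boundedFrom : ∀ i b → Sorted b → CountsFrom i b → T (boundedFrom i b)
CountsFrom⇒boundedFrom i []       _  _      = tt
CountsFrom⇒boundedFrom i (x ∷ bs) b↗ counts with x ≤? i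
... | yes x≤i = CountsFrom⇒boundedFrom (suc i) bs (sorted-tail b↗) λ k 1+i≤k k<1+i+|bs| →
  let i≤k = ≤-trans (n≤1+n i) 1+i≤k in
  subst (suc k ≤_) (trans (cong (_+ i) (countLe-∷-≤ bs (≤-trans x≤i i≤k))) (sym (+-suc _ i)))
    (counts k i≤k (subst (k <_) (sym (+-suc i (length bs))) k<1+i+|bs|))
... | no  x≰i = ⊥-elim (1+n≰n (subst (suc i ≤_) (cong (_+ i) none≤i) (counts i ≤-refl (m<m+n i (s≤s z≤n)))))
  where
  i<x : i < x
  i<x = ≰⇒> x≰i
  none≤i : countLe i (x ∷ bs) ≡ 0
  none≤i = countLe-none (x ∷ bs) (i<x ∷ All-map (<-≤-trans i<x) (sorted-head b↗))

isPF⇒ParkingCounts : ∀ π → T (isPF? π) → ParkingCounts π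
isPF⇒ParkingCounts π isPF k 1≤k k≤n =
  ≤-pred (subst (suc k ≤_) (trans (cong (_+ 1) (countLe-↭ k (sort-↭ π))) (+-comm _ 1))
    (boundedFrom⇒CountsFrom 1 (sort π) (sort-↗ π) isPF k 1≤k
       (s≤s (subst (k ≤_) (sym (↭-length (sort-↭ π))) k≤n))))

ParkingCounts⇒isPF : ∀ π → ParkingCounts π → T (isPF? π)
ParkingCounts⇒isPF π counts = CountsFrom⇒boundedFrom 1 (sort π) (sort-↗ π) λ k 1≤k k<1+n →
  subst (suc k ≤_) (trans (+-comm 1 _) (cong (_+ 1) (sym (countLe-↭ k (sort-↭ π)))))
    (s≤s (counts k 1≤k (subst (k ≤_) (↭-length (sort-↭ π)) (≤-pred k<1+n))))

-- Rotations

rotate : ℕ → ℕ → ℕ → ℕ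
rotate m c v = if ⌊ v + c ≤? m ⌋ then v + c else v + c ∸ m

-- Rotating {1,…,c+j} by c, the images ≤ c + i (i ≤ j) are the entries ≤ i and the wrapped entries (> j);
-- the images ≤ k < c are the wrapped entries ≤ j + k.
𝟙-rotate-high : ∀ c j i v → i ≤ j → v ≤ c + j →
  𝟙[ rotate (c + j) c v ≤ c + i ] + 𝟙[ v ≤ j ] ≡ 𝟙[ v ≤ i ] + 1
𝟙-rotate-high c j i v i≤j v≤c+j with v + c ≤? c + j
... | yes v+c≤c+j = cong₂ _+_
        (𝟙[≤]-cong (λ v+c≤c+i → +-cancelˡ-≤ c v i (subst (_≤ c + i) (+-comm v c) v+c≤c+i))
                   (λ v≤i → subst (_≤ c + i) (+-comm c v) (+-monoʳ-≤ c v≤i)))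
        (𝟙[≤]-yes (+-cancelˡ-≤ c v j (subst (_≤ c + j) (+-comm v c) v+c≤c+j)))
... | no  v+c≰c+j = begin
  𝟙[ v + c ∸ (c + j) ≤ c + i ] + 𝟙[ v ≤ j ]
    ≡⟨ cong₂ _+_ (𝟙[≤]-yes (≤-trans wrapped≤c (m≤m+n c i))) (𝟙[≤]-no j<v) ⟩
  1
    ≡⟨ cong (_+ 1) (𝟙[≤]-no (<-≤-trans (s≤s i≤j) j<v)) ⟨
  𝟙[ v ≤ i ] + 1 ∎
  where
  j<v : j < v
  j<v = ≰⇒> (λ v≤j → v+c≰c+j (subst (_≤ c + j) (+-comm c v) (+-monoʳ-≤ c v≤j)))
  wrapped≤c : v + c ∸ (c + j) ≤ c
  wrapped≤c = m≤n+o⇒m∸n≤o (v + c) (c + j) (+-monoˡ-≤ c v≤c+j)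

𝟙-rotate-low : ∀ c j k v → k < c → v ≤ c + j → 𝟙[ rotate (c + j) c v ≤ k ] + 𝟙[ v ≤ j ] ≡ 𝟙[ v ≤ j + k ]
𝟙-rotate-low c j k v k<c v≤c+j with v + c ≤? c + j
... | yes v+c≤c+j = begin
  𝟙[ v + c ≤ k ] + 𝟙[ v ≤ j ] ≡⟨ cong₂ _+_ (𝟙[≤]-no (<-≤-trans k<c (m≤n+m c v))) (𝟙[≤]-yes v≤j) ⟩
  1                           ≡⟨ 𝟙[≤]-yes (≤-trans v≤j (m≤m+n j k)) ⟨
  𝟙[ v ≤ j + k ]              ∎
  where
  v≤j : v ≤ j
  v≤j = +-cancelˡ-≤ c v j (subst (_≤ c + j) (+-comm v c) v+c≤c+j)
... | no  v+c≰c+j = begin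
  𝟙[ v + c ∸ (c + j) ≤ k ] + 𝟙[ v ≤ j ]
    ≡⟨ cong₂ _+_ (cong (λ w → 𝟙[ w ≤ k ]) wrapped≡v∸j) (𝟙[≤]-no j<v) ⟩
  𝟙[ v ∸ j ≤ k ] + 0
    ≡⟨ +-identityʳ _ ⟩
  𝟙[ v ∸ j ≤ k ]
    ≡⟨ 𝟙[≤]-cong (λ v∸j≤k → ≤-trans (m≤n+m∸n v j) (+-monoʳ-≤ j v∸j≤k)) (m≤n+o⇒m∸n≤o v j) ⟩
  𝟙[ v ≤ j + k ] ∎
  where
  j<v : j < v
  j<v = ≰⇒> (λ v≤j → v+c≰c+j (subst (_≤ c + j) (+-comm c v) (+-monoʳ-≤ c v≤j)))
  wrapped≡v∸j : v + c ∸ (c + j) ≡ v ∸ j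
  wrapped≡v∸j = trans (cong (_∸ (c + j)) (+-comm v c)) ([m+n]∸[m+o]≡n∸o c v j)

countLe-rotate-high : ∀ c j i π → i ≤ j → All (InRange (c + j)) π →
  countLe (c + i) (map (rotate (c + j) c) π) + countLe j π ≡ countLe i π + length π
countLe-rotate-high c j i []      i≤j []                = refl
countLe-rotate-high c j i (v ∷ π) i≤j ((_ , v≤c+j) ∷ π∈) = begin
  (𝟙[ rotate (c + j) c v ≤ c + i ] + countLe (c + i) (map (rotate (c + j) c) π)) + (𝟙[ v ≤ j ] + countLe j π)
    ≡⟨ interchange 𝟙[ rotate (c + j) c v ≤ c + i ] _ 𝟙[ v ≤ j ] _ ⟩
  (𝟙[ rotate (c + j) c v ≤ c + i ] + 𝟙[ v ≤ j ]) + (countLe (c + i) (map (rotate (c + j) c) π) + countLe j π)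
    ≡⟨ cong₂ _+_ (𝟙-rotate-high c j i v i≤j v≤c+j) (countLe-rotate-high c j i π i≤j π∈) ⟩
  (𝟙[ v ≤ i ] + 1) + (countLe i π + length π)
    ≡⟨ interchange 𝟙[ v ≤ i ] 1 (countLe i π) (length π) ⟩
  countLe i (v ∷ π) + length (v ∷ π) ∎

countLe-rotate-low : ∀ c j k π → k < c → All (InRange (c + j)) π →
  countLe k (map (rotate (c + j) c) π) + countLe j π ≡ countLe (j + k) π
countLe-rotate-low c j k []      k<c []                = refl
countLe-rotate-low c j k (v ∷ π) k<c ((_ , v≤c+j) ∷ π∈) = begin
  (𝟙[ rotate (c + j) c v ≤ k ] + countLe k (map (rotate (c + j) c) π)) + (𝟙[ v ≤ j ] + countLe j π)
    ≡⟨ interchange 𝟙[ rotate (c + j) c v ≤ k ] _ 𝟙[ v ≤ j ] _ ⟩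
  (𝟙[ rotate (c + j) c v ≤ k ] + 𝟙[ v ≤ j ]) + (countLe k (map (rotate (c + j) c) π) + countLe j π)
    ≡⟨ cong₂ _+_ (𝟙-rotate-low c j k v k<c v≤c+j) (countLe-rotate-low c j k π k<c π∈) ⟩
  countLe (j + k) (v ∷ π) ∎

rotate-injective : ∀ m c {v w} → InRange m v → InRange m w → rotate m c v ≡ rotate m c w → v ≡ w
rotate-injective m c {v} {w} (1≤v , v≤m) (1≤w , w≤m) eq with v + c ≤? m | w + c ≤? m
... | yes _     | yes _     = +-cancelʳ-≡ c v w eq
... | no  v+c≰m | no  w+c≰m = +-cancelʳ-≡ c v w (begin
  v + c         ≡⟨ m∸n+n≡m (<⇒≤ (≰⇒> v+c≰m)) ⟨
  v + c ∸ m + m ≡⟨ cong (_+ m) eq ⟩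
  w + c ∸ m + m ≡⟨ m∸n+n≡m (<⇒≤ (≰⇒> w+c≰m)) ⟩
  w + c         ∎)
... | yes _     | no  _     = ⊥-elim (1+n≰n (≤-trans (subst (suc c ≤_) eq (+-monoˡ-≤ c 1≤v))
                                                     (m≤n+o⇒m∸n≤o (w + c) m (+-monoˡ-≤ c w≤m))))
... | no  _     | yes _     = ⊥-elim (1+n≰n (≤-trans (subst (suc c ≤_) (sym eq) (+-monoˡ-≤ c 1≤w))
                                                     (m≤n+o⇒m∸n≤o (v + c) m (+-monoˡ-≤ c v≤m))))

countEq-rotate : ∀ m c x π → InRange m x → All (InRange m) π →
  countEq (rotate m c x) (map (rotate m c) π) ≡ countEq x π
countEq-rotate m c x []      x∈ []        = refl
countEq-rotate m c x (y ∷ π) x∈ (y∈ ∷ π∈) with rotate m c y ≟ rotate m c x | y ≟ x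
... | yes _  | yes _    = cong suc (countEq-rotate m c x π x∈ π∈)
... | no  _  | no  _    = countEq-rotate m c x π x∈ π∈
... | yes eq | no  y≢x  = ⊥-elim (y≢x (rotate-injective m c y∈ x∈ eq))
... | no  ne | yes refl = ⊥-elim (ne refl)

lel-rotate : ∀ m c π → All (InRange m) π → lel (map (rotate m c) π) ≡ lel π
lel-rotate m c []      _          = refl
lel-rotate m c (x ∷ π) (x∈ ∷ π∈) = countEq-rotate m c x (x ∷ π) x∈ (x∈ ∷ π∈)

nlel-rotate : ∀ m c π → All (InRange m) π → nlel (map (rotate m c) π) ≡ nlel π
nlel-rotate m c []          _                = refl
nlel-rotate m c (x ∷ [])    _                = refl
nlel-rotate m c (x ∷ y ∷ π) (x∈ ∷ y∈ ∷ π∈) = countEq-rotate m c y (x ∷ y ∷ π) y∈ (x∈ ∷ y∈ ∷ π∈)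

sumTo-rotate : ∀ m c g → c ≤ m → sumTo m (g ∘ rotate m c) ≡ sumTo m g
sumTo-rotate m c g c≤m =
  subst (λ m → sumTo m (g ∘ rotate m c) ≡ sumTo m g) (m∸n+n≡m c≤m) (rotate-d+c (m ∸ c))
  where
  rotate-d+c : ∀ d → sumTo (d + c) (g ∘ rotate (d + c) c) ≡ sumTo (d + c) g
  rotate-d+c d = begin
    sumTo (d + c) (g ∘ rotate (d + c) c)
      ≡⟨ sumTo-splitAt d c _ ⟩
    sumTo d (g ∘ rotate (d + c) c) + sumTo c (λ i → g (rotate (d + c) c (d + i)))
      ≡⟨ cong₂ _+_ (sumTo-cong d no-wrap) (sumTo-cong c wrap) ⟩
    sumTo d (λ x → g (c + x)) + sumTo c g
      ≡⟨ +-comm _ (sumTo c g) ⟩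
    sumTo c g + sumTo d (λ x → g (c + x))
      ≡⟨ sumTo-splitAt c d g ⟨
    sumTo (c + d) g
      ≡⟨ cong (λ z → sumTo z g) (+-comm c d) ⟩
    sumTo (d + c) g ∎
    where
    no-wrap : ∀ x → 1 ≤ x → x ≤ d → g (rotate (d + c) c x) ≡ g (c + x)
    no-wrap x _ x≤d with x + c ≤? d + c
    ... | yes _       = cong g (+-comm x c)
    ... | no  x+c≰d+c = ⊥-elim (x+c≰d+c (+-monoˡ-≤ c x≤d))
    wrap : ∀ i → 1 ≤ i → i ≤ c → g (rotate (d + c) c (d + i)) ≡ g i
    wrap i 1≤i _ with d + i + c ≤? d + c
    ... | yes d+i+c≤d+c = ⊥-elim (1+n≰n (+-cancelˡ-≤ d (suc c) c
                            (≤-trans (+-monoʳ-≤ d (+-monoˡ-≤ c 1≤i)) (subst (_≤ d + c) (+-assoc d i c) d+i+c≤d+c))))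
    ... | no  _         = cong g (begin
      d + i + c ∸ (d + c)   ≡⟨ cong (_∸ (d + c)) (solve 3 (λ d i c → d :+ i :+ c := d :+ c :+ i) refl d i c) ⟩
      d + c + i ∸ (d + c)   ≡⟨ m+n∸m≡n (d + c) i ⟩
      i                     ∎)

sumWords-rotate : ∀ m c k F → c ≤ m → sumWords m k (F ∘ map (rotate m c)) ≡ sumWords m k F
sumWords-rotate m c zero    F c≤m = refl
sumWords-rotate m c (suc k) F c≤m =
  trans (sumTo-cong m (λ x _ _ → sumWords-rotate m c k (F ∘ (rotate m c x ∷_)) c≤m))
        (sumTo-rotate m c (λ y → sumWords m k (F ∘ (y ∷_))) c≤m)

-- Pollak's cycle lemma

-- With f i = countLe i π − i, FirstMin m π j says f j < f i for i < j and f j ≤ f i for j < i < m.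
FirstMin : ℕ → List ℕ → ℕ → Set
FirstMin m π j = (∀ i → i < j → suc (countLe j π + i) ≤ countLe i π + j)
               × (∀ i → j < i → i < m → countLe j π + i ≤ countLe i π + j)

offset-<⇒ : ∀ c i j n X Y → c + j ≡ suc n → c + i + X ≤ Y + n → suc (X + i) ≤ Y + j
offset-<⇒ c i j n X Y c+j≡1+n le = +-cancelʳ-≤ c (suc (X + i)) (Y + j)
  (subst₂ _≤_ (solve 3 (λ c i X → con 1 :+ (c :+ i :+ X) := con 1 :+ X :+ i :+ c) refl c i X)
              (trans (sym (+-suc Y n)) (trans (cong (Y +_) (sym c+j≡1+n))
                                               (solve 3 (λ Y c j → Y :+ (c :+ j) := Y :+ j :+ c) refl Y c j)))
              (s≤s le))

offset-<⇐ : ∀ c i j n X Y → c + j ≡ suc n → suc (X + i) ≤ Y + j → c + i + X ≤ Y + n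
offset-<⇐ c i j n X Y c+j≡1+n lt = ≤-pred
  (subst₂ _≤_ (solve 3 (λ c i X → con 1 :+ X :+ i :+ c := con 1 :+ (c :+ i :+ X)) refl c i X)
              (trans (solve 3 (λ Y c j → Y :+ j :+ c := Y :+ (c :+ j)) refl Y c j) (trans (cong (Y +_) c+j≡1+n) (+-suc Y n)))
              (+-monoˡ-≤ c lt))

ParkingCounts-rotate⇒FirstMin : ∀ c j π → c + j ≡ suc (length π) → All (InRange (c + j)) π →
  ParkingCounts (map (rotate (c + j) c) π) → FirstMin (c + j) π j
ParkingCounts-rotate⇒FirstMin c j π c+j≡1+n π∈ parks = before , after
  where
  n = length π
  π' = map (rotate (c + j) c) π
  parks' : ∀ k → 1 ≤ k → k ≤ n → k ≤ countLe k π'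
  parks' k 1≤k k≤n = parks k 1≤k (subst (k ≤_) (sym (length-map _ π)) k≤n)
  before : ∀ i → i < j → suc (countLe j π + i) ≤ countLe i π + j
  before i i<j with c + i ≟ 0
  ... | yes c+i≡0 with m+n≡0⇒m≡0 c c+i≡0 | m+n≡0⇒n≡0 c c+i≡0
  ...   | refl | refl = subst₂ _≤_ (cong suc (sym (+-identityʳ _)))
                          (trans (sym c+j≡1+n) (cong (_+ j) (sym (countLe-none π (All-map proj₁ π∈)))))
                          (s≤s (countLe-≤-length j π))
  before i i<j | no c+i≢0 = offset-<⇒ c i j n (countLe j π) (countLe i π) c+j≡1+n
     (≤-trans (+-monoˡ-≤ (countLe j π) (parks' (c + i) (n≢0⇒n>0 c+i≢0) c+i≤n))
              (≤-reflexive (countLe-rotate-high c j i π (<⇒≤ i<j) π∈)))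
    where
    c+i≤n : c + i ≤ n
    c+i≤n = ≤-pred (subst (c + i <_) c+j≡1+n (+-monoʳ-< c i<j))
  after : ∀ i → j < i → i < c + j → countLe j π + i ≤ countLe i π + j
  after i j<i i<c+j = subst₂ _≤_ (cong (countLe j π +_) j+k≡i) (cong (λ i → countLe i π + j) j+k≡i)
      (subst (_≤ countLe (j + k) π + j) (solve 3 (λ a j k → k :+ a :+ j := a :+ (j :+ k)) refl (countLe j π) j k)
        (+-monoˡ-≤ j (≤-trans (+-monoˡ-≤ (countLe j π) (parks' k 1≤k k≤n))
                              (≤-reflexive (countLe-rotate-low c j k π k<c π∈)))))
    where
    k = i ∸ j
    j+k≡i : j + k ≡ i
    j+k≡i = m+[n∸m]≡n (<⇒≤ j<i)
    k<c : k < c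
    k<c = +-cancelˡ-< j k c (subst (_< j + c) (sym j+k≡i) (subst (i <_) (+-comm c j) i<c+j))
    1≤k : 1 ≤ k
    1≤k = +-cancelˡ-≤ j 1 k (subst₂ _≤_ (+-comm 1 j) (sym j+k≡i) j<i)
    k≤n : k ≤ n
    k≤n = ≤-pred (subst (k <_) c+j≡1+n (<-≤-trans k<c (m≤m+n c j)))

FirstMin⇒ParkingCounts-rotate : ∀ c j π → c + j ≡ suc (length π) → All (InRange (c + j)) π →
  FirstMin (c + j) π j → ParkingCounts (map (rotate (c + j) c) π)
FirstMin⇒ParkingCounts-rotate c j π c+j≡1+n π∈ (before , after) k 1≤k k≤n' with c ≤? k
... | yes c≤k = +-cancelʳ-≤ (countLe j π) k (countLe k π')
      (≤-trans (subst (λ k → k + countLe j π ≤ countLe i π + n) c+i≡k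
                  (offset-<⇐ c i j n (countLe j π) (countLe i π) c+j≡1+n (before i i<j)))
               (≤-reflexive (sym (subst (λ k → countLe k π' + countLe j π ≡ countLe i π + n) c+i≡k
                                   (countLe-rotate-high c j i π (<⇒≤ i<j) π∈)))))
  where
  n = length π
  π' = map (rotate (c + j) c) π
  i = k ∸ c
  c+i≡k : c + i ≡ k
  c+i≡k = m+[n∸m]≡n c≤k
  i<j : i < j
  i<j = +-cancelˡ-< c i j (subst (_< c + j) (sym c+i≡k)
          (subst (k <_) (sym c+j≡1+n) (s≤s (subst (k ≤_) (length-map _ π) k≤n'))))
... | no  c≰k = +-cancelʳ-≤ (countLe j π) k (countLe k π')
      (≤-trans (+-cancelʳ-≤ j (k + countLe j π) (countLe (j + k) π)
                  (subst (_≤ countLe (j + k) π + j) (solve 3 (λ a j k → a :+ (j :+ k) := k :+ a :+ j) refl (countLe j π) j k)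
                     (after (j + k) (subst (_≤ j + k) (+-comm j 1) (+-monoʳ-≤ j 1≤k))
                                    (subst (j + k <_) (+-comm j c) (+-monoʳ-< j k<c)))))
               (≤-reflexive (sym (countLe-rotate-low c j k π k<c π∈))))
  where
  π' = map (rotate (c + j) c) π
  k<c : k < c
  k<c = ≰⇒> c≰k

leftmostMin : ∀ (F : ℕ → ℕ) M →
  ∃ λ j → j ≤ M × (∀ i → i < j → F j < F i) × (∀ i → j < i → i ≤ M → F j ≤ F i)
leftmostMin F zero = 0 , z≤n , (λ _ ()) , (λ i 0<i i≤0 → ⊥-elim (<⇒≱ 0<i i≤0))
leftmostMin F (suc M) with leftmostMin F M
... | j , j≤M , before , after with F (suc M) <? F j
...   | yes new = suc M , ≤-refl , before' , (λ i 1+M<i i≤1+M → ⊥-elim (<⇒≱ 1+M<i i≤1+M))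
  where
  before' : ∀ i → i < suc M → F (suc M) < F i
  before' i i<1+M with <-cmp i j
  ... | tri< i<j _ _    = <-trans new (before i i<j)
  ... | tri≈ _ refl _   = new
  ... | tri> _ _ j<i    = <-≤-trans new (after i j<i (≤-pred i<1+M))
...   | no  old = j , m≤n⇒m≤1+n j≤M , before , after'
  where
  after' : ∀ i → j < i → i ≤ suc M → F j ≤ F i
  after' i j<i i≤1+M with i ≟ suc M
  ... | yes refl   = ≮⇒≥ old
  ... | no  i≢1+M  = after i j<i (≤-pred (≤∧≢⇒< i≤1+M i≢1+M))

offset-≤ : ∀ {m i j X Y} → i ≤ m → j ≤ m → X + (m ∸ j) ≤ Y + (m ∸ i) → X + i ≤ Y + j
offset-≤ {m} {i} {j} {X} {Y} i≤m j≤m le = +-cancelʳ-≤ m (X + i) (Y + j) (subst₂ _≤_ eqˡ eqʳ (+-monoˡ-≤ (i + j) le))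
  where
  eqˡ : X + (m ∸ j) + (i + j) ≡ X + i + m
  eqˡ = trans (solve 4 (λ X d i j → X :+ d :+ (i :+ j) := X :+ i :+ (d :+ j)) refl X (m ∸ j) i j)
              (cong (X + i +_) (m∸n+n≡m j≤m))
  eqʳ : Y + (m ∸ i) + (i + j) ≡ Y + j + m
  eqʳ = trans (solve 4 (λ Y d i j → Y :+ d :+ (i :+ j) := Y :+ j :+ (d :+ i)) refl Y (m ∸ i) i j)
              (cong (Y + j +_) (m∸n+n≡m i≤m))

module _ (π : List ℕ) (π∈ : All (InRange (suc (length π))) π) where
  private
    n = length π
    m = suc n

  private
    countLe-0 : countLe 0 π ≡ 0
    countLe-0 = countLe-none π (All-map proj₁ π∈)

    countLe-m : countLe m π ≡ n
    countLe-m = countLe-all π (All-map proj₂ π∈)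

    FirstMin-ordered : ∀ j j' → 1 ≤ j → j < j' → j' ≤ m → FirstMin m π j → FirstMin m π j' → ⊥
    FirstMin-ordered j j' 1≤j j<j' j'≤m (before , after) (before' , _) with j' ≟ m
    ... | no  j'≢m = 1+n≰n (≤-trans (subst₂ _≤_ (cong suc (+-comm (countLe j' π) j)) refl (before' j j<j'))
                                     (subst₂ _≤_ refl (+-comm (countLe j' π) j) (after j' j<j' (≤∧≢⇒< j'≤m j'≢m))))
    -- j' = m: f j > f m = f 0 − 1, yet f j < f 0 as 0 < j
    ... | yes refl = 1+n≰n (≤-trans (subst₂ _≤_ (cong suc (+-identityʳ _)) (cong (_+ j) countLe-0) (before 0 1≤j))
                                     j≤countLe)
      where
      j≤countLe : j ≤ countLe j π
      j≤countLe = +-cancelʳ-≤ m j (countLe j π)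
        (subst₂ _≤_ (trans (cong suc (+-comm n j)) (sym (+-suc j n))) refl
          (subst (λ c → suc (c + j) ≤ countLe j π + m) countLe-m (before' j j<j')))

  FirstMin-unique : ∀ j j' → 1 ≤ j → j ≤ m → 1 ≤ j' → j' ≤ m → FirstMin m π j → FirstMin m π j' → j ≡ j'
  FirstMin-unique j j' 1≤j j≤m 1≤j' j'≤m fj fj' with <-cmp j j'
  ... | tri< j<j' _ _ = ⊥-elim (FirstMin-ordered j j' 1≤j j<j' j'≤m fj fj')
  ... | tri≈ _ j≡j' _ = j≡j'
  ... | tri> _ _ j'<j = ⊥-elim (FirstMin-ordered j' j 1≤j' j'<j j≤m fj' fj)

  -- a leftmost minimiser of f on {0,…,n}, where a minimum at 0 is moved to m (f m = f 0 − 1)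
  FirstMin-exists : ∃ λ j → 1 ≤ j × j ≤ m × FirstMin m π j
  FirstMin-exists with leftmostMin (λ i → countLe i π + (m ∸ i)) n
  ... | suc j , 1+j≤n , before , after =
    suc j , s≤s z≤n , j≤m ,
    (λ i i<j → offset-≤ (<⇒≤ (<-≤-trans i<j j≤m)) j≤m (before i i<j)) ,
    (λ i j<i i<m → offset-≤ (<⇒≤ i<m) j≤m (after i j<i (≤-pred i<m)))
    where
    j≤m : suc j ≤ m
    j≤m = m≤n⇒m≤1+n 1+j≤n
  ... | zero , _ , _ , after = m , s≤s z≤n , ≤-refl , before-m , (λ i m<i i<m → ⊥-elim (<-asym m<i i<m))
    where
    i≤countLe : ∀ i → i < m → i ≤ countLe i π
    i≤countLe zero    _     = z≤n
    i≤countLe (suc i) 1+i<m = subst₂ _≤_ (cong (_+ suc i) countLe-0) (+-identityʳ _)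
      (offset-≤ {m} {suc i} {0} (<⇒≤ 1+i<m) z≤n (after (suc i) (s≤s z≤n) (≤-pred 1+i<m)))
    before-m : ∀ i → i < m → suc (countLe m π + i) ≤ countLe i π + m
    before-m i i<m = subst₂ _≤_ (trans (+-suc i n) (cong suc (trans (+-comm i n) (cong (_+ i) (sym countLe-m))))) refl
                       (+-monoˡ-≤ m (i≤countLe i i<m))

  private
    rotation-parks⇒FirstMin : ∀ j → j ≤ m → T (isPF? (map (rotate m (m ∸ j)) π)) → FirstMin m π j
    rotation-parks⇒FirstMin j j≤m parks =
      subst (λ M → All (InRange M) π → ParkingCounts (map (rotate M (m ∸ j)) π) → FirstMin M π j) m∸j+j≡m
        (ParkingCounts-rotate⇒FirstMin (m ∸ j) j π m∸j+j≡m) π∈ (isPF⇒ParkingCounts (map (rotate m (m ∸ j)) π) parks)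
      where
      m∸j+j≡m = m∸n+n≡m j≤m

    FirstMin⇒rotation-parks : ∀ j → j ≤ m → FirstMin m π j → T (isPF? (map (rotate m (m ∸ j)) π))
    FirstMin⇒rotation-parks j j≤m fj = ParkingCounts⇒isPF (map (rotate m (m ∸ j)) π)
      (subst (λ M → All (InRange M) π → FirstMin M π j → ParkingCounts (map (rotate M (m ∸ j)) π)) m∸j+j≡m
        (FirstMin⇒ParkingCounts-rotate (m ∸ j) j π m∸j+j≡m) π∈ fj)
      where
      m∸j+j≡m = m∸n+n≡m j≤m

  exactly-one-rotation-parks : sumTo m (λ j → 𝟙 (isPF? (map (rotate m (m ∸ j)) π))) ≡ 1
  exactly-one-rotation-parks with FirstMin-exists
  ... | j , 1≤j , j≤m , fj = sumTo-𝟙-unique m _ (j , 1≤j , j≤m , FirstMin⇒rotation-parks j j≤m fj)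
    (λ j j' 1≤j j≤m 1≤j' j'≤m parks parks' → FirstMin-unique j j' 1≤j j≤m 1≤j' j'≤m
        (rotation-parks⇒FirstMin j j≤m parks) (rotation-parks⇒FirstMin j' j'≤m parks'))

sumWords-pollak : ∀ n (P : List ℕ → Bool) →
  (∀ π c → Word (suc n) n π → c ≤ n → P (map (rotate (suc n) c) π) ≡ P π) →
  sumWords (suc n) n (𝟙 ∘ P) ≡ suc n * sumWords (suc n) n (λ π → 𝟙 (P π ∧ isPF? π))
sumWords-pollak n P P-rotate = begin
  sumWords m n (𝟙 ∘ P)
    ≡⟨ sumWords-cong m n (λ π π∈ → sym (trans (cong (𝟙 (P π) *_) (one-parks π π∈)) (*-identityʳ _))) ⟩
  sumWords m n (λ π → 𝟙 (P π) * sumTo m (λ j → 𝟙 (isPF? (map (rotate m (m ∸ j)) π))))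
    ≡⟨ sumWords-cong m n (λ π _ → sym (sumTo-𝟙∧ m (P π) _)) ⟩
  sumWords m n (λ π → sumTo m (λ j → 𝟙 (P π ∧ isPF? (map (rotate m (m ∸ j)) π))))
    ≡⟨ sumWords-sumTo m n m _ ⟩
  sumTo m (λ j → sumWords m n (λ π → 𝟙 (P π ∧ isPF? (map (rotate m (m ∸ j)) π))))
    ≡⟨ sumTo-cong m (λ j 1≤j _ → trans (sumWords-cong m n (λ π π∈ →
                                         cong (λ b → 𝟙 (b ∧ isPF? (map (rotate m (m ∸ j)) π)))
                                              (sym (P-rotate π (m ∸ j) π∈ (m∸j≤n j 1≤j)))))
                                       (sumWords-rotate m (m ∸ j) n (λ π → 𝟙 (P π ∧ isPF? π)) (m∸n≤m m j))) ⟩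
  sumTo m (λ _ → sumWords m n (λ π → 𝟙 (P π ∧ isPF? π)))
    ≡⟨ sumTo-const m _ ⟩
  m * sumWords m n (λ π → 𝟙 (P π ∧ isPF? π)) ∎
  where
  m = suc n
  one-parks : ∀ π → Word m n π → sumTo m (λ j → 𝟙 (isPF? (map (rotate m (m ∸ j)) π))) ≡ 1
  one-parks π (refl , π∈) = exactly-one-rotation-parks π π∈
  m∸j≤n : ∀ j → 1 ≤ j → m ∸ j ≤ n
  m∸j≤n (suc j) _ = m∸n≤m n j

parking-bounded : ∀ π → 1 ≤ length π → T (isPF? π) → All (_≤ length π) π
parking-bounded π 1≤n parks with all? (_≤? length π) π
... | yes π≤n = π≤n
... | no  π≰n = ⊥-elim (<⇒≱ (countLe-<-length (length π) π π≰n)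
                            (isPF⇒ParkingCounts π parks (length π) 1≤n ≤-refl))

lelNlel? : ℕ → ℕ → List ℕ → Bool
lelNlel? a b π = ⌊ lel π ≟ a ⌋ ∧ ⌊ nlel π ≟ b ⌋

countPF-pollak : ∀ n a b → 1 ≤ n → suc n * countPF n a b ≡ sumWords (suc n) n (𝟙 ∘ lelNlel? a b)
countPF-pollak n a b 1≤n = sym (begin
  sumWords (suc n) n (𝟙 ∘ lelNlel? a b)
    ≡⟨ sumWords-pollak n (lelNlel? a b) (λ π c (_ , π∈) _ → cong₂ (λ l l' → ⌊ l ≟ a ⌋ ∧ ⌊ l' ≟ b ⌋)
                                                              (lel-rotate (suc n) c π π∈) (nlel-rotate (suc n) c π π∈)) ⟩
  suc n * sumWords (suc n) n (λ π → 𝟙 (lelNlel? a b π ∧ isPF? π))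
    ≡⟨ cong (suc n *_) (sumWords-restrict n n _ not-parking) ⟩
  suc n * sumWords n n (λ π → 𝟙 (lelNlel? a b π ∧ isPF? π))
    ≡⟨ cong (suc n *_) (sumWords-cong n n (λ π _ → cong 𝟙 (∧-comm (lelNlel? a b π) (isPF? π)))) ⟩
  suc n * sumWords n n (λ π → 𝟙 (isPF? π ∧ lelNlel? a b π))
    ≡⟨ cong (suc n *_) (length-filter-seqs n n _) ⟨
  suc n * countPF n a b ∎)
  where
  not-parking : ∀ π → Word (suc n) n π → ¬ All (_≤ n) π → 𝟙 (lelNlel? a b π ∧ isPF? π) ≡ 0
  not-parking π (refl , _) π≰n with isPF? π in parks
  ... | true  = ⊥-elim (π≰n (parking-bounded π 1≤n (subst T (sym parks) tt)))
  ... | false = cong 𝟙 (∧-zeroʳ _)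

-- Words with prescribed letter multiplicities

occurs? : ℕ → ℕ → List ℕ → Bool
occurs? x a ρ = ⌊ countEq x ρ ≟ a ⌋

≟-suc : ∀ c a → ⌊ suc c ≟ suc a ⌋ ≡ ⌊ c ≟ a ⌋
≟-suc c a with suc c ≟ suc a | c ≟ a
... | yes _   | yes _   = refl
... | no  _   | no  _   = refl
... | yes eq  | no  c≢a = ⊥-elim (c≢a (suc-injective eq))
... | no  ne  | yes eq  = ⊥-elim (ne (cong suc eq))

countEq-∷-≡ : ∀ x ρ → countEq x (x ∷ ρ) ≡ suc (countEq x ρ)
countEq-∷-≡ x ρ with x ≟ x
... | yes _   = refl
... | no  x≢x = ⊥-elim (x≢x refl)

countEq-∷-≢ : ∀ {x z} ρ → z ≢ x → countEq x (z ∷ ρ) ≡ countEq x ρ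
countEq-∷-≢ {x} {z} ρ z≢x with z ≟ x
... | yes z≡x = ⊥-elim (z≢x z≡x)
... | no  _   = refl

occurs?-∷-≡-zero : ∀ x ρ → occurs? x 0 (x ∷ ρ) ≡ false
occurs?-∷-≡-zero x ρ = cong (λ c → ⌊ c ≟ 0 ⌋) (countEq-∷-≡ x ρ)

occurs?-∷-≡-suc : ∀ x a ρ → occurs? x (suc a) (x ∷ ρ) ≡ occurs? x a ρ
occurs?-∷-≡-suc x a ρ = trans (cong (λ c → ⌊ c ≟ suc a ⌋) (countEq-∷-≡ x ρ)) (≟-suc (countEq x ρ) a)

occurs?-∷-≢ : ∀ {x z} a ρ → z ≢ x → occurs? x a (z ∷ ρ) ≡ occurs? x a ρ
occurs?-∷-≢ a ρ z≢x = cong (λ c → ⌊ c ≟ a ⌋) (countEq-∷-≢ ρ z≢x)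

-- C(j,b) q^(j−b) counts the words in {1,…,q+1}^j with exactly b copies of a given letter
binomPow : ℕ → ℕ → ℕ → ℕ
binomPow q j b = (j C b) * q ^ (j ∸ b)

binomPowPred : ℕ → ℕ → ℕ → ℕ
binomPowPred q j zero    = 0
binomPowPred q j (suc b) = binomPow q j b

C-suc-∸ : ∀ j b (f : ℕ → ℕ) → (j C suc b) * f (j ∸ b) ≡ (j C suc b) * f (suc (j ∸ suc b))
C-suc-∸ j b f with b <? j
... | yes b<j = cong (λ e → (j C suc b) * f e) (+-∸-assoc 1 b<j)
... | no  b≮j = trans (cong (_* f (j ∸ b)) C≡0) (sym (cong (_* f (suc (j ∸ suc b))) C≡0))
  where
  C≡0 : j C suc b ≡ 0
  C≡0 = k>n⇒nCk≡0 (s≤s (≮⇒≥ b≮j))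

binomPow-suc : ∀ q j b → binomPow q (suc j) b ≡ binomPowPred q j b + q * binomPow q j b
binomPow-suc q j zero     = solve 2 (λ q r → con 1 :* (q :* r) := q :* (con 1 :* r)) refl q (q ^ j)
binomPow-suc q j (suc b) = begin
  (suc j C suc b) * q ^ (j ∸ b)                          ≡⟨ cong (_* q ^ (j ∸ b)) (nCk+nC[k+1]≡[n+1]C[k+1] j b) ⟨
  (j C b + j C suc b) * q ^ (j ∸ b)                      ≡⟨ *-distribʳ-+ (q ^ (j ∸ b)) (j C b) _ ⟩
  binomPow q j b + (j C suc b) * q ^ (j ∸ b)             ≡⟨ cong (binomPow q j b +_) (C-suc-∸ j b (q ^_)) ⟩
  binomPow q j b + (j C suc b) * (q * q ^ (j ∸ suc b))   ≡⟨ cong (binomPow q j b +_) (*-left-comm (j C suc b) q _) ⟩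
  binomPow q j b + q * binomPow q j (suc b)              ∎

sumWords-occurs? : ∀ q k a x → InRange (suc q) x → sumWords (suc q) k (𝟙 ∘ occurs? x a) ≡ binomPow q k a
sumWords-occurs? q zero    zero    x _ = refl
sumWords-occurs? q zero    (suc a) x _ = refl
sumWords-occurs? q (suc k) a x x∈@(1≤x , x≤1+q) = +-cancelʳ-≡ (binomPow q k a) _ _ (begin
  sumTo (suc q) first + binomPow q k a
    ≡⟨ sumTo-except₁ (suc q) x _ _ first 1≤x x≤1+q (first-x a) first-other ⟩
  binomPowPred q k a + suc q * binomPow q k a
    ≡⟨ solve 3 (λ A B q → A :+ (con 1 :+ q) :* B := A :+ q :* B :+ B) refl (binomPowPred q k a) (binomPow q k a) q ⟩
  binomPowPred q k a + q * binomPow q k a + binomPow q k a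
    ≡⟨ cong (_+ binomPow q k a) (binomPow-suc q k a) ⟨
  binomPow q (suc k) a + binomPow q k a ∎)
  where
  first : ℕ → ℕ
  first z = sumWords (suc q) k (λ ρ → 𝟙 (occurs? x a (z ∷ ρ)))
  first-x : ∀ a → sumWords (suc q) k (λ ρ → 𝟙 (occurs? x a (x ∷ ρ))) ≡ binomPowPred q k a
  first-x zero    = sumWords-zero (suc q) k _ (λ ρ _ → cong 𝟙 (occurs?-∷-≡-zero x ρ))
  first-x (suc a) = trans (sumWords-cong (suc q) k (λ ρ _ → cong 𝟙 (occurs?-∷-≡-suc x a ρ)))
                          (sumWords-occurs? q k a x x∈)
  first-other : ∀ z → 1 ≤ z → z ≤ suc q → z ≢ x → first z ≡ binomPow q k a
  first-other z _ _ z≢x = trans (sumWords-cong (suc q) k (λ ρ _ → cong 𝟙 (occurs?-∷-≢ a ρ z≢x)))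
                                (sumWords-occurs? q k a x x∈)

-- C(k,a) C(k−a,b) p^(k−a−b) counts the words in {1,…,p+2}^k with exactly a copies of one given letter
-- and b of another
trinomPow : ℕ → ℕ → ℕ → ℕ → ℕ
trinomPow p k a b = (k C a) * binomPow p (k ∸ a) b

trinomPowPredˡ : ℕ → ℕ → ℕ → ℕ → ℕ
trinomPowPredˡ p k zero    b = 0
trinomPowPredˡ p k (suc a) b = trinomPow p k a b

trinomPowPredʳ : ℕ → ℕ → ℕ → ℕ → ℕ
trinomPowPredʳ p k a b = (k C a) * binomPowPred p (k ∸ a) b

trinomPow-suc : ∀ p k a b →
  trinomPow p (suc k) a b ≡ trinomPowPredˡ p k a b + trinomPowPredʳ p k a b + p * trinomPow p k a b
trinomPow-suc p k zero     b = trans (cong (1 *_) (binomPow-suc p k b))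
  (solve 3 (λ X p Y → con 1 :* (X :+ p :* Y) := con 0 :+ con 1 :* X :+ p :* (con 1 :* Y)) refl
     (binomPowPred p k b) p (binomPow p k b))
trinomPow-suc p k (suc a) b = begin
  (suc k C suc a) * binomPow p (k ∸ a) b
    ≡⟨ cong (_* binomPow p (k ∸ a) b) (nCk+nC[k+1]≡[n+1]C[k+1] k a) ⟨
  (k C a + k C suc a) * binomPow p (k ∸ a) b
    ≡⟨ *-distribʳ-+ (binomPow p (k ∸ a) b) (k C a) _ ⟩
  trinomPow p k a b + (k C suc a) * binomPow p (k ∸ a) b
    ≡⟨ cong (trinomPow p k a b +_) (C-suc-∸ k a (λ e → binomPow p e b)) ⟩
  trinomPow p k a b + (k C suc a) * binomPow p (suc (k ∸ suc a)) b
    ≡⟨ cong (λ t → trinomPow p k a b + (k C suc a) * t) (binomPow-suc p (k ∸ suc a) b) ⟩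
  trinomPow p k a b + (k C suc a) * (binomPowPred p (k ∸ suc a) b + p * binomPow p (k ∸ suc a) b)
    ≡⟨ cong (trinomPow p k a b +_) (trans (*-distribˡ-+ (k C suc a) _ _)
                                          (cong (trinomPowPredʳ p k (suc a) b +_) (*-left-comm (k C suc a) p _))) ⟩
  trinomPow p k a b + (trinomPowPredʳ p k (suc a) b + p * trinomPow p k (suc a) b)
    ≡⟨ +-assoc (trinomPow p k a b) _ _ ⟨
  trinomPow p k a b + trinomPowPredʳ p k (suc a) b + p * trinomPow p k (suc a) b ∎

sumWords-occurs?₂ : ∀ p k a b x y → x ≢ y → InRange (2 + p) x → InRange (2 + p) y →
  sumWords (2 + p) k (λ ρ → 𝟙 (occurs? x a ρ ∧ occurs? y b ρ)) ≡ trinomPow p k a b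
sumWords-occurs?₂ p zero    zero    zero    x y _ _ _ = refl
sumWords-occurs?₂ p zero    zero    (suc b) x y _ _ _ = refl
sumWords-occurs?₂ p zero    (suc a) b       x y _ _ _ = refl
sumWords-occurs?₂ p (suc k) a b x y x≢y x∈@(1≤x , x≤m) y∈@(1≤y , y≤m) = +-cancelʳ-≡ (W + W) _ _ (begin
  sumTo m first + (W + W)
    ≡⟨ +-assoc (sumTo m first) W W ⟨
  sumTo m first + W + W
    ≡⟨ sumTo-except₂ m x y _ _ W first x≢y 1≤x x≤m 1≤y y≤m (first-x a) (first-y b) first-other ⟩
  trinomPowPredˡ p k a b + trinomPowPredʳ p k a b + m * W
    ≡⟨ solve 4 (λ A B p W → A :+ B :+ (con 2 :+ p) :* W := A :+ B :+ p :* W :+ (W :+ W)) refl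
         (trinomPowPredˡ p k a b) (trinomPowPredʳ p k a b) p W ⟩
  trinomPowPredˡ p k a b + trinomPowPredʳ p k a b + p * W + (W + W)
    ≡⟨ cong (_+ (W + W)) (trinomPow-suc p k a b) ⟨
  trinomPow p (suc k) a b + (W + W) ∎)
  where
  m = 2 + p
  W = trinomPow p k a b
  y≢x : y ≢ x
  y≢x = x≢y ∘ sym
  first : ℕ → ℕ
  first z = sumWords m k (λ ρ → 𝟙 (occurs? x a (z ∷ ρ) ∧ occurs? y b (z ∷ ρ)))
  first-x : ∀ a → sumWords m k (λ ρ → 𝟙 (occurs? x a (x ∷ ρ) ∧ occurs? y b (x ∷ ρ))) ≡ trinomPowPredˡ p k a b
  first-x zero    = sumWords-zero m k _ (λ ρ _ → cong (λ o → 𝟙 (o ∧ occurs? y b (x ∷ ρ))) (occurs?-∷-≡-zero x ρ))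
  first-x (suc a) = trans (sumWords-cong m k (λ ρ _ → cong₂ (λ o o' → 𝟙 (o ∧ o'))
                                                        (occurs?-∷-≡-suc x a ρ) (occurs?-∷-≢ b ρ x≢y)))
                          (sumWords-occurs?₂ p k a b x y x≢y x∈ y∈)
  first-y : ∀ b → sumWords m k (λ ρ → 𝟙 (occurs? x a (y ∷ ρ) ∧ occurs? y b (y ∷ ρ))) ≡ trinomPowPredʳ p k a b
  first-y zero    = trans (sumWords-zero m k _ (λ ρ _ →
                            trans (cong (λ o → 𝟙 (occurs? x a (y ∷ ρ) ∧ o)) (occurs?-∷-≡-zero y ρ)) (cong 𝟙 (∧-zeroʳ _))))
                          (sym (*-zeroʳ (k C a)))
  first-y (suc b) = trans (sumWords-cong m k (λ ρ _ → cong₂ (λ o o' → 𝟙 (o ∧ o'))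
                                                        (occurs?-∷-≢ a ρ y≢x) (occurs?-∷-≡-suc y b ρ)))
                          (sumWords-occurs?₂ p k a b x y x≢y x∈ y∈)
  first-other : ∀ z → 1 ≤ z → z ≤ m → z ≢ x → z ≢ y → first z ≡ W
  first-other z _ _ z≢x z≢y = trans (sumWords-cong m k (λ ρ _ → cong₂ (λ o o' → 𝟙 (o ∧ o'))
                                                                  (occurs?-∷-≢ a ρ z≢x) (occurs?-∷-≢ b ρ z≢y)))
                                    (sumWords-occurs?₂ p k a b x y x≢y x∈ y∈)

lelNlel?-distinct : ∀ s t x y ρ → x ≢ y →
  lelNlel? (suc s) (suc t) (x ∷ y ∷ ρ) ≡ (occurs? x s ρ ∧ occurs? y t ρ)
lelNlel?-distinct s t x y ρ x≢y = cong₂ _∧_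
  (trans (occurs?-∷-≡-suc x s (y ∷ ρ)) (occurs?-∷-≢ s ρ (x≢y ∘ sym)))
  (trans (occurs?-∷-≢ (suc t) (y ∷ ρ) x≢y) (occurs?-∷-≡-suc y t ρ))

≟∧≟-≢ : ∀ c {a b} → a ≢ b → (⌊ c ≟ a ⌋ ∧ ⌊ c ≟ b ⌋) ≡ false
≟∧≟-≢ c {a} {b} a≢b with c ≟ a | c ≟ b
... | yes refl | yes refl = ⊥-elim (a≢b refl)
... | yes _    | no  _    = refl
... | no  _    | _        = refl

lelNlel?-repeated : ∀ a b x ρ →
  lelNlel? a b (x ∷ x ∷ ρ) ≡ (⌊ 2 + countEq x ρ ≟ a ⌋ ∧ ⌊ 2 + countEq x ρ ≟ b ⌋)
lelNlel?-repeated a b x ρ =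
  cong (λ c → ⌊ c ≟ a ⌋ ∧ ⌊ c ≟ b ⌋) (trans (countEq-∷-≡ x (x ∷ ρ)) (cong suc (countEq-∷-≡ x ρ)))

-- Split the words of {1,…,n+1}^n by their first two letters: a repeated first letter contributes D,
-- each of the n(n+1) ordered pairs of distinct letters contributes trinomPow (n − 1) (n − 2) s t.
countPF-by-first-two : ∀ k s t D →
  (∀ x → InRange (3 + k) x → sumWords (3 + k) k (λ ρ → 𝟙 (lelNlel? (suc s) (suc t) (x ∷ x ∷ ρ))) ≡ D) →
  countPF (2 + k) (suc s) (suc t) ≡ D + (2 + k) * trinomPow (suc k) k s t
countPF-by-first-two k s t D repeated = *-cancelˡ-≡ _ _ m (begin
  m * countPF n (suc s) (suc t)
    ≡⟨ countPF-pollak n (suc s) (suc t) (s≤s z≤n) ⟩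
  sumTo m (λ x → sumTo m (λ y → sumWords m k (λ ρ → 𝟙 (lelNlel? (suc s) (suc t) (x ∷ y ∷ ρ)))))
    ≡⟨ sumTo-cong m (λ x 1≤x x≤m → +-cancelʳ-≡ W _ _
         (trans (sumTo-except₁ m x D W _ 1≤x x≤m (repeated x (1≤x , x≤m)) (distinct x 1≤x x≤m))
                (solve 3 (λ D W k → D :+ (con 3 :+ k) :* W := D :+ (con 2 :+ k) :* W :+ W) refl D W k))) ⟩
  sumTo m (λ _ → D + n * W)
    ≡⟨ sumTo-const m _ ⟩
  m * (D + n * W) ∎)
  where
  n = 2 + k
  m = 3 + k
  W = trinomPow (suc k) k s t
  distinct : ∀ x → 1 ≤ x → x ≤ m → ∀ y → 1 ≤ y → y ≤ m → y ≢ x →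
    sumWords m k (λ ρ → 𝟙 (lelNlel? (suc s) (suc t) (x ∷ y ∷ ρ))) ≡ W
  distinct x 1≤x x≤m y 1≤y y≤m y≢x =
    trans (sumWords-cong m k (λ ρ _ → cong 𝟙 (lelNlel?-distinct s t x y ρ (y≢x ∘ sym))))
          (sumWords-occurs?₂ (suc k) k s t x y (y≢x ∘ sym) (1≤x , x≤m) (1≤y , y≤m))

multinom3≡C*C : ∀ k s t → multinom3 k s t ≡ (k C s) * ((k ∸ s) C t)
multinom3≡C*C k s t with s + t ≤? k
... | yes _     = refl
... | no  s+t≰k with s ≤? k
...   | no  s≰k = sym (cong (_* ((k ∸ s) C t)) (k>n⇒nCk≡0 (≰⇒> s≰k)))
...   | yes s≤k = sym (trans (cong ((k C s) *_) (k>n⇒nCk≡0 k∸s<t)) (*-zeroʳ (k C s)))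
  where
  k∸s<t : k ∸ s < t
  k∸s<t = ≰⇒> (λ t≤k∸s → s+t≰k (subst (s + t ≤_) (m+[n∸m]≡n s≤k) (+-monoʳ-≤ s t≤k∸s)))

distinct-starts-closed-form : ∀ k s t →
  (2 + k) * trinomPow (suc k) k s t ≡ multinom3 k s t * (2 + k) * suc k ^ (2 + k ∸ s ∸ t ∸ 2)
distinct-starts-closed-form k s t = begin
  n * ((k C s) * (((k ∸ s) C t) * suc k ^ (k ∸ s ∸ t)))
    ≡⟨ solve 4 (λ n a b c → n :* (a :* (b :* c)) := a :* b :* n :* c) refl
         n (k C s) ((k ∸ s) C t) (suc k ^ (k ∸ s ∸ t)) ⟩
  (k C s) * ((k ∸ s) C t) * n * suc k ^ (k ∸ s ∸ t)
    ≡⟨ cong₂ (λ c e → c * n * suc k ^ e) (sym (multinom3≡C*C k s t)) (sym exponent) ⟩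
  multinom3 k s t * n * suc k ^ (n ∸ s ∸ t ∸ 2) ∎
  where
  n = 2 + k
  exponent : n ∸ s ∸ t ∸ 2 ≡ k ∸ s ∸ t
  exponent = begin
    n ∸ s ∸ t ∸ 2     ≡⟨ cong (_∸ 2) (∸-+-assoc n s t) ⟩
    n ∸ (s + t) ∸ 2   ≡⟨ ∸-+-assoc n (s + t) 2 ⟩
    n ∸ (s + t + 2)   ≡⟨ cong (n ∸_) (+-comm (s + t) 2) ⟩
    k ∸ (s + t)       ≡⟨ ∸-+-assoc k s t ⟨
    k ∸ s ∸ t         ∎

repeated-start-≢ : ∀ k s t x → s ≢ t → sumWords (3 + k) k (λ ρ → 𝟙 (lelNlel? (suc s) (suc t) (x ∷ x ∷ ρ))) ≡ 0
repeated-start-≢ k s t x s≢t = sumWords-zero (3 + k) k _ (λ ρ _ → cong 𝟙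
  (trans (lelNlel?-repeated (suc s) (suc t) x ρ) (≟∧≟-≢ (2 + countEq x ρ) (s≢t ∘ suc-injective))))

repeated-start-closed-form : ∀ k s x → InRange (3 + k) x →
  sumWords (3 + k) k (λ ρ → 𝟙 (lelNlel? (suc s) (suc s) (x ∷ x ∷ ρ))) ≡ binomPred k s * (2 + k) ^ (2 + k ∸ s ∸ 1)
repeated-start-closed-form k zero     x _  =
  sumWords-zero (3 + k) k _ (λ ρ _ → cong 𝟙 (lelNlel?-repeated 1 1 x ρ))
repeated-start-closed-form k (suc s) x x∈ = begin
  sumWords (3 + k) k (λ ρ → 𝟙 (lelNlel? (2 + s) (2 + s) (x ∷ x ∷ ρ)))
    ≡⟨ sumWords-cong (3 + k) k (λ ρ _ → cong 𝟙 (trans (lelNlel?-repeated (2 + s) (2 + s) x ρ)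
                                                  (trans (∧-idem _) (trans (≟-suc _ _) (≟-suc _ _))))) ⟩
  sumWords (3 + k) k (𝟙 ∘ occurs? x s)
    ≡⟨ sumWords-occurs? (2 + k) k s x x∈ ⟩
  (k C s) * (2 + k) ^ (k ∸ s)
    ≡⟨ cong (λ e → (k C s) * (2 + k) ^ e) exponent ⟨
  (k C s) * (2 + k) ^ (suc k ∸ s ∸ 1) ∎
  where
  exponent : suc k ∸ s ∸ 1 ≡ k ∸ s
  exponent = trans (∸-+-assoc (suc k) s 1) (cong (suc k ∸_) (+-comm s 1))

proposition4p10 : (n s t : ℕ) → 2 ≤ n →
    (s ≢ t → countPF n (suc s) (suc t) ≡ multinom3 (n ∸ 2) s t * n * (n ∸ 1) ^ (n ∸ s ∸ t ∸ 2))
    × (s ≡ t → countPF n (suc s) (suc s)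
         ≡ multinom3 (n ∸ 2) s s * n * (n ∸ 1) ^ (n ∸ s ∸ s ∸ 2) + binomPred (n ∸ 2) s * n ^ (n ∸ s ∸ 1))
proposition4p10 (suc (suc k)) s t (s≤s (s≤s z≤n)) = distinct , same
  where
  distinct : s ≢ t → countPF (2 + k) (suc s) (suc t) ≡ multinom3 k s t * (2 + k) * suc k ^ (2 + k ∸ s ∸ t ∸ 2)
  distinct s≢t = trans (countPF-by-first-two k s t 0 (λ x _ → repeated-start-≢ k s t x s≢t))
                       (distinct-starts-closed-form k s t)
  same : s ≡ t → countPF (2 + k) (suc s) (suc s)
    ≡ multinom3 k s s * (2 + k) * suc k ^ (2 + k ∸ s ∸ s ∸ 2) + binomPred k s * (2 + k) ^ (2 + k ∸ s ∸ 1)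
  same refl = trans (countPF-by-first-two k s s D (repeated-start-closed-form k s))
                    (trans (+-comm D _) (cong (_+ D) (distinct-starts-closed-form k s s)))
    where
    D = binomPred k s * (2 + k) ^ (2 + k ∸ s ∸ 1)
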